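{- Let $G$ be a finite simple graph with maximum degree $\Delta(G)$, and let $K$ be a clique of $G$. If $G-K$ is odd $m$-colorable for some integer $m\ge 2\Delta(G)-|K|+3$, then $G$ is odd $m$-colorable.
   Context: An odd $m$-coloring of a graph is a proper coloring with colors from $\{1,\dots,m\}$ (adjacent vertices receive different colors) such that every vertex of positive degree has some color appearing an odd number of times on its neighborhood. A graph is odd $m$-colorable if it has an odd $m$-coloring. $G-K$ denotes the graph obtained by deleting the vertices of $K$. -}

module Defs where

open import Data.Nat using (ℕ; zero; suc; _+_; _*_; _<_; _≤_; _⊔_; _%_)
open import Data.Fin using (Fin; zero; suc)
open import Data.Fin.Properties using (_≟_)
open import Data.Bool using (Bool; true; false; not; if_then_else_; _∧_)
open import Data.Vec using (Vec; []; _∷_; map; lookup)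
open import Data.List using (List; length; filter; foldr) renaming (map to mapL)
open import Data.List using (allFin)
open import Data.Product using (Σ; ∃; _×_)
open import Relation.Binary.PropositionalEquality using (_≡_; _≢_)
open import Relation.Nullary using (Dec; yes; no; ¬_)

record Graph : Set where
  field
    n     : ℕ
    Adj   : Fin n → Fin n → Bool
    sym   : ∀ u v → Adj u v ≡ Adj v u
    irrefl : ∀ v → Adj v v ≡ false
open Graph public

countB : {A : Set} → (A → Bool) → List A → ℕ
countB p Data.List.[]  = 0
countB p (x Data.List.∷ xs) = if p x then suc (countB p xs) else countB p xs

deg : (G : Graph) → Fin (n G) → ℕ
deg G v = countB (Adj G v) (allFin (n G))

maxDeg : Graph → ℕ
maxDeg G = foldr (λ v acc → deg G v ⊔ acc) 0 (allFin (n G))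

-- vertex subsets as Boolean vectors, their size, and the order-preserving
-- embedding of Fin (size S) onto the members of S
Subset : ℕ → Set
Subset n = Vec Bool n

size : ∀ {k} → Subset k → ℕ
size []          = 0
size (true ∷ s)  = suc (size s)
size (false ∷ s) = size s

emb : ∀ {k} (S : Subset k) → Fin (size S) → Fin k
emb (true ∷ s) zero    = zero
emb (true ∷ s) (suc i) = suc (emb s i)
emb (false ∷ s) i      = suc (emb s i)

IsClique : (G : Graph) → Subset (n G) → Set
IsClique G K = ∀ u v → lookup K u ≡ true → lookup K v ≡ true → u ≢ v → Adj G u v ≡ true

induced : (G : Graph) → Subset (n G) → Graph
induced G S = record
  { n = size S
  ; Adj = λ i j → Adj G (emb S i) (emb S j)
  ; sym = λ i j → sym G (emb S i) (emb S j)
  ; irrefl = λ i → irrefl G (emb S i)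
  }

_minus_ : (G : Graph) → Subset (n G) → Graph
G minus K = induced G (map not K)

nbrsColoured : (G : Graph) {m : ℕ} → (Fin (n G) → Fin m) → Fin (n G) → Fin m → ℕ
nbrsColoured G c v k =
  countB (λ u → Adj G v u ∧ (Relation.Nullary.does (c u ≟ k))) (allFin (n G))

IsOddColoring : (G : Graph) (m : ℕ) → (Fin (n G) → Fin m) → Set
IsOddColoring G m c =
  (∀ u v → Adj G u v ≡ true → c u ≢ c v) ×
  (∀ v → 0 < deg G v → ∃ λ (k : Fin m) → nbrsColoured G c v k % 2 ≡ 1)

OddColorable : Graph → ℕ → Set
OddColorable G m = Σ (Fin (n G) → Fin m) (IsOddColoring G m)

{-# OPTIONS --safe #-}
module Submission where

-- Let φ be an odd colouring of G − K and, for each vertex j outside K with a neighbour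
-- outside K, let ψ j be a colour occurring an odd number of times around j. A vertex x of
-- the clique K has at most Δ − |K| + 1 neighbours outside K, so after forbidding their
-- φ- and ψ-colours x still has |K| + 1 colours left; colouring K injectively from these
-- lists gives a proper colouring in which every vertex j outside K has an odd colour:
-- ψ j, or, if all neighbours of j lie in K, any colour of a neighbour.
-- Since x sees each colour of K − x exactly once, x fails to be odd exactly when the
-- colours odd among its outside neighbours are the colours of K − x. A failure at v is
-- repaired by giving another vertex w an unused colour; if that makes some u fail, then
-- u's forbidden colours contain all colours of K but those of u and w, which leaves room
-- to recolour u instead so that nothing fails, and two repairs suffice.
-- For |K| ≤ 1 we have m ≥ 2Δ + 2, and G is odd m-colourable vertex by vertex: a new
-- vertex without an odd colour gets one by recolouring one of its neighbours.

open import Defs hiding (sym)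

open import Data.Bool using (Bool; true; false; not; if_then_else_; _∧_; _∨_; _xor_)
open import Data.Bool.Properties using (not-involutive; not-distribˡ-xor; ∨-zeroʳ; ∨-identityʳ; T-≡; ¬-not)
import Data.Bool.Properties as Bool
open import Data.Fin using (Fin; zero; suc)
open import Data.Fin.Properties using (_≟_; suc-injective; any?; all?; ¬∀⟶∃¬; pigeonhole; <⇒≢)
open import Data.Fin.Subset using (∁; ∣_∣; ⁅_⁆)
open import Data.Fin.Subset.Properties using (∣⁅x⁆∣≡1; ∣∁p∣≡n∸∣p∣)
open import Data.List using (List; []; _∷_; _++_; length; allFin; tabulate; foldr; filter; map)
import Data.List as List
open import Data.List.Membership.Propositional using (_∈_; _∉_)
open import Data.List.Membership.Propositional.Properties
  using (∈-allFin; ∈-++⁺ˡ; ∈-++⁺ʳ; ∈-map⁺; ∈-filter⁺; ∈-tabulate⁺)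
import Data.List.Membership.DecPropositional as DecMembership
open import Data.List.Properties using (length-++; length-map; length-tabulate)
open import Data.List.Relation.Unary.Any using (here; there; index)
open import Data.List.Relation.Unary.Any.Properties using (lookup-index)
open import Data.Nat using (ℕ; zero; suc; _+_; _*_; _∸_; _≤_; _<_; _%_; _⊔_; z≤n; s≤s; _<?_; _≤?_)
import Data.Nat as ℕ
open import Data.Nat.Properties
  using ( ≤-trans; ≤-reflexive; ≤-pred; m≤n⇒m≤1+n; n≤0⇒n≡0; ≮⇒≥; ≰⇒>; m≤m+n; m≤n+m
        ; +-suc; +-comm; +-assoc; +-identityʳ; +-mono-≤; +-monoˡ-≤; +-monoʳ-≤; *-monoʳ-≤
        ; +-cancelʳ-≤; +-cancelʳ-≡; m≤m⊔n; m≤n⊔m; ⊔-lub; module ≤-Reasoning)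
open import Data.Nat.Tactic.RingSolver using (solve-∀)
open import Data.Product using (∃; _×_; _,_; proj₁; proj₂)
open import Data.Vec using ([]; _∷_)
import Data.Vec as Vec
open import Data.Vec.Functional using (updateAt) renaming (_∷_ to _◂_)
open import Data.Vec.Functional.Properties using (updateAt-updates; updateAt-minimal)
open import Function using (_∘_; const; Equivalence)
open import Function.Definitions using (Injective)
open import Relation.Binary.PropositionalEquality
open import Relation.Nullary using (Dec; yes; no; does; ¬_; ¬?; _×-dec_; contradiction)
open import Relation.Nullary.Decidable using (dec-true; dec-false; T?)
open import Relation.Unary using (Decidable)

-- Counting and parity

count : ∀ {n} → (Fin n → Bool) → ℕ
count {zero}  p = 0
count {suc n} p = if p zero then suc (count (p ∘ suc)) else count (p ∘ suc)

countB-tabulate : ∀ {A : Set} {n} (p : A → Bool) (f : Fin n → A) → countB p (tabulate f) ≡ count (p ∘ f)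
countB-tabulate {n = zero}  p f = refl
countB-tabulate {n = suc n} p f with p (f zero)
... | true  = cong suc (countB-tabulate p (f ∘ suc))
... | false = countB-tabulate p (f ∘ suc)

countB-allFin : ∀ {n} (p : Fin n → Bool) → countB p (allFin n) ≡ count p
countB-allFin p = countB-tabulate p (λ i → i)

count-cong : ∀ {n} {p q : Fin n → Bool} → (∀ i → p i ≡ q i) → count p ≡ count q
count-cong {zero}  eq = refl
count-cong {suc n} {p} {q} eq rewrite eq zero with q zero
... | true  = cong suc (count-cong (eq ∘ suc))
... | false = count-cong (eq ∘ suc)

count-mono : ∀ {n} {p q : Fin n → Bool} → (∀ i → p i ≡ true → q i ≡ true) → count p ≤ count q
count-mono {zero} imp = z≤n
count-mono {suc n} {p} {q} imp with p zero in p0 | q zero in q0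
... | true  | true  = s≤s (count-mono (imp ∘ suc))
... | true  | false = contradiction (trans (sym (imp zero p0)) q0) λ ()
... | false | true  = m≤n⇒m≤1+n (count-mono (imp ∘ suc))
... | false | false = count-mono (imp ∘ suc)

count≤n : ∀ {n} (p : Fin n → Bool) → count p ≤ n
count≤n {zero}  p = z≤n
count≤n {suc n} p with p zero
... | true  = s≤s (count≤n (p ∘ suc))
... | false = m≤n⇒m≤1+n (count≤n (p ∘ suc))

count-false : ∀ {n} {p : Fin n → Bool} → (∀ i → p i ≡ false) → count p ≡ 0
count-false {zero}      none = refl
count-false {suc n} {p} none rewrite none zero = count-false (none ∘ suc)

count-pos : ∀ {n} (p : Fin n → Bool) → 0 < count p → ∃ λ i → p i ≡ true
count-pos {suc n} p pos with p zero in p0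
... | true  = zero , p0
... | false with count-pos (p ∘ suc) pos
...   | i , pi = suc i , pi

count-insert : ∀ {n} {p q : Fin n → Bool} i → p i ≡ false → q i ≡ true →
  (∀ j → j ≢ i → p j ≡ q j) → count q ≡ suc (count p)
count-insert {suc n} {p} {q} zero pi qi rest rewrite pi | qi =
  cong suc (count-cong λ j → sym (rest (suc j) λ ()))
count-insert {suc n} {p} {q} (suc i) pi qi rest rewrite rest zero (λ ()) with q zero
... | true  = cong suc (count-insert i pi qi λ j j≢i → rest (suc j) (j≢i ∘ suc-injective))
... | false = count-insert i pi qi λ j j≢i → rest (suc j) (j≢i ∘ suc-injective)

count-true : ∀ {n} → count {n} (const true) ≡ n
count-true {zero}  = refl
count-true {suc n} = cong suc (count-true {n})

count-add : ∀ {n} (p : Fin n → Bool) {a} → p a ≡ false →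
  count (λ i → p i ∨ does (i ≟ a)) ≡ suc (count p)
count-add p {a} pa = count-insert a pa (trans (cong (p a ∨_) (dec-true (a ≟ a) refl)) (∨-zeroʳ _))
  λ j j≢a → trans (sym (∨-identityʳ (p j))) (cong (p j ∨_) (sym (dec-false (j ≟ a) j≢a)))

count+2≤n : ∀ {n} (p : Fin n → Bool) {a b} → a ≢ b → p a ≡ false → p b ≡ false → count p + 2 ≤ n
count+2≤n {n} p {a} {b} a≢b pa pb = begin
  count p + 2         ≡⟨ +-comm (count p) 2 ⟩
  suc (suc (count p)) ≡⟨ cong suc (count-add p pa) ⟨
  suc (count p₁)      ≡⟨ count-add p₁ p₁b ⟨
  count p₂            ≤⟨ count≤n p₂ ⟩
  n                   ∎
  where
  open ≤-Reasoning
  p₁ p₂ : Fin n → Bool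
  p₁ i = p i ∨ does (i ≟ a)
  p₂ i = p₁ i ∨ does (i ≟ b)
  p₁b : p₁ b ≡ false
  p₁b = trans (cong (_∨ does (b ≟ a)) pb) (dec-false (b ≟ a) (a≢b ∘ sym))

length-filter : ∀ {A : Set} {P : A → Set} (P? : Decidable P) xs →
  length (filter P? xs) ≡ countB (does ∘ P?) xs
length-filter P? []       = refl
length-filter P? (x ∷ xs) with does (P? x)
... | true  = cong suc (length-filter P? xs)
... | false = length-filter P? xs

length-filter-allFin : ∀ {n} {P : Fin n → Set} (P? : Decidable P) →
  length (filter P? (allFin n)) ≡ count (does ∘ P?)
length-filter-allFin P? = trans (length-filter P? (allFin _)) (countB-allFin (does ∘ P?))

isOdd : ℕ → Bool
isOdd zero    = false
isOdd (suc n) = not (isOdd n)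

isOdd-+ : ∀ a b → isOdd (a + b) ≡ isOdd a xor isOdd b
isOdd-+ zero    b = refl
isOdd-+ (suc a) b = trans (cong not (isOdd-+ a b)) (not-distribˡ-xor (isOdd a) (isOdd b))

isOdd⇒%2≡1 : ∀ n → isOdd n ≡ true → n % 2 ≡ 1
isOdd⇒%2≡1 1             _   = refl
isOdd⇒%2≡1 (suc (suc n)) odd = isOdd⇒%2≡1 n (trans (sym (not-involutive _)) odd)

%2≡1⇒isOdd : ∀ n → n % 2 ≡ 1 → isOdd n ≡ true
%2≡1⇒isOdd 1             _ = refl
%2≡1⇒isOdd (suc (suc n)) r = trans (not-involutive _) (%2≡1⇒isOdd n r)

isOdd-count-unique : ∀ {n} {P : Fin n → Set} (P? : Decidable P) → (∀ {i j} → P i → P j → i ≡ j) →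
  isOdd (count (does ∘ P?)) ≡ does (any? P?)
isOdd-count-unique {n} P? unique with any? P?
... | yes (i , Pi) = cong isOdd (trans (count-insert i refl (dec-true (P? i) Pi) λ j j≢i →
                        sym (dec-false (P? j) λ Pj → j≢i (unique Pj Pi))) (cong suc (count-false {n} λ _ → refl)))
... | no ¬∃P       = cong isOdd (count-false λ i → dec-false (P? i) λ Pi → ¬∃P (i , Pi))

∧≡true⇒left : ∀ {a b} → a ∧ b ≡ true → a ≡ true
∧≡true⇒left {true} _ = refl

isOdd⇒pos : ∀ {n} → isOdd n ≡ true → 0 < n
isOdd⇒pos {suc n} _ = s≤s z≤n

xor-≢ : ∀ {a b} → a ≢ b → a xor b ≡ true
xor-≢ {true}  {true}  a≢b = contradiction refl a≢b
xor-≢ {true}  {false} _   = refl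
xor-≢ {false} {true}  _   = refl
xor-≢ {false} {false} a≢b = contradiction refl a≢b

module _ {m : ℕ} where
  open DecMembership (_≟_ {m}) using (_∈?_)

  missing-colour : (xs : List (Fin m)) → length xs < m → ∃ λ γ → γ ∉ xs
  missing-colour xs short with all? (_∈? xs)
  ... | no ¬all = ¬∀⟶∃¬ m _ (_∈? xs) ¬all
  ... | yes all with i , j , i<j , same ← pigeonhole short (index ∘ all) =
    contradiction (trans (lookup-index (all i)) (trans (cong (List.lookup xs) same) (sym (lookup-index (all j)))))
                  (<⇒≢ i<j)

-- Subsets of the vertex set

lookup-emb : ∀ {n} (S : Subset n) i → Vec.lookup S (emb S i) ≡ true
lookup-emb (true ∷ S)  zero    = refl
lookup-emb (true ∷ S)  (suc i) = lookup-emb S i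
lookup-emb (false ∷ S) i       = lookup-emb S i

emb-injective : ∀ {n} (S : Subset n) → Injective _≡_ _≡_ (emb S)
emb-injective (true ∷ S)  {zero}  {zero}  _  = refl
emb-injective (true ∷ S)  {suc i} {suc j} eq = cong suc (emb-injective S (suc-injective eq))
emb-injective (false ∷ S)                 eq = emb-injective S (suc-injective eq)

emb-elim : ∀ {n} (S : Subset n) {P : Fin n → Set} →
  (∀ i → P (emb S i)) → (∀ j → P (emb (∁ S) j)) → ∀ v → P v
emb-elim (true ∷ S)  inside outside zero    = inside zero
emb-elim (true ∷ S)  inside outside (suc v) = emb-elim S (inside ∘ suc) outside v
emb-elim (false ∷ S) inside outside zero    = outside zero
emb-elim (false ∷ S) inside outside (suc v) = emb-elim S inside (outside ∘ suc) v

emb-surjective : ∀ {n} (S : Subset n) {u} → Vec.lookup S u ≡ true → ∃ λ i → emb S i ≡ u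
emb-surjective (true ∷ S)  {zero}  _   = zero , refl
emb-surjective (true ∷ S)  {suc u} u∈S = let i , eq = emb-surjective S u∈S in suc i , cong suc eq
emb-surjective (false ∷ S) {suc u} u∈S = let i , eq = emb-surjective S u∈S in i , cong suc eq

count-split : ∀ {n} (S : Subset n) (p : Fin n → Bool) →
  count p ≡ count (p ∘ emb S) + count (p ∘ emb (∁ S))
count-split []          p = refl
count-split (true ∷ S)  p with p zero
... | true  = cong suc (count-split S (p ∘ suc))
... | false = count-split S (p ∘ suc)
count-split (false ∷ S) p with p zero
... | true  = trans (cong suc (count-split S (p ∘ suc))) (sym (+-suc _ _))
... | false = count-split S (p ∘ suc)

glue : ∀ {n} {A : Set} (S : Subset n) → (Fin (size S) → A) → (Fin (size (∁ S)) → A) → Fin n → A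
glue (true ∷ S)  f g zero    = f zero
glue (true ∷ S)  f g (suc v) = glue S (f ∘ suc) g v
glue (false ∷ S) f g zero    = g zero
glue (false ∷ S) f g (suc v) = glue S f (g ∘ suc) v

glue-emb : ∀ {n} {A : Set} (S : Subset n) (f : Fin (size S) → A) g i → glue S f g (emb S i) ≡ f i
glue-emb (true ∷ S)  f g zero    = refl
glue-emb (true ∷ S)  f g (suc i) = glue-emb S (f ∘ suc) g i
glue-emb (false ∷ S) f g i       = glue-emb S f (g ∘ suc) i

glue-emb∁ : ∀ {n} {A : Set} (S : Subset n) (f : Fin (size S) → A) g j → glue S f g (emb (∁ S) j) ≡ g j
glue-emb∁ (true ∷ S)  f g j       = glue-emb∁ S (f ∘ suc) g j
glue-emb∁ (false ∷ S) f g zero    = refl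
glue-emb∁ (false ∷ S) f g (suc j) = glue-emb∁ S f (g ∘ suc) j

size≡∣∣ : ∀ {n} (S : Subset n) → size S ≡ ∣ S ∣
size≡∣∣ []          = refl
size≡∣∣ (true ∷ S)  = cong suc (size≡∣∣ S)
size≡∣∣ (false ∷ S) = size≡∣∣ S

-- Degrees

module _ {A : Set} (f : A → ℕ) where

  ≤-foldr-⊔ : ∀ {x xs} → x ∈ xs → f x ≤ foldr (λ y acc → f y ⊔ acc) 0 xs
  ≤-foldr-⊔ (here refl) = m≤m⊔n _ _
  ≤-foldr-⊔ {xs = y ∷ _} (there x∈xs) = ≤-trans (≤-foldr-⊔ x∈xs) (m≤n⊔m (f y) _)

  foldr-⊔-lub : ∀ {D} xs → (∀ x → f x ≤ D) → foldr (λ y acc → f y ⊔ acc) 0 xs ≤ D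
  foldr-⊔-lub []       bound = z≤n
  foldr-⊔-lub (x ∷ xs) bound = ⊔-lub (bound x) (foldr-⊔-lub xs bound)

deg≤maxDeg : ∀ G v → deg G v ≤ maxDeg G
deg≤maxDeg G v = ≤-foldr-⊔ (deg G) (∈-allFin v)

maxDeg-lub : ∀ G {D} → (∀ v → deg G v ≤ D) → maxDeg G ≤ D
maxDeg-lub G = foldr-⊔-lub (deg G) (allFin (n G))

deg-split : ∀ G (S : Subset (n G)) v →
  deg G v ≡ count (Adj G v ∘ emb S) + count (Adj G v ∘ emb (∁ S))
deg-split G S v = trans (countB-allFin (Adj G v)) (count-split S (Adj G v))

deg-minus : ∀ G K j → deg (G minus K) j ≤ deg G (emb (∁ K) j)
deg-minus G K j = begin
  deg (G minus K) j                         ≡⟨ countB-allFin (Adj (G minus K) j) ⟩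
  count (Adj G u ∘ emb (∁ K))               ≤⟨ m≤n+m _ (count (Adj G u ∘ emb K)) ⟩
  count (Adj G u ∘ emb K) + count (Adj G u ∘ emb (∁ K)) ≡⟨ deg-split G K u ⟨
  deg G u                                   ∎
  where
  open ≤-Reasoning
  u = emb (∁ K) j

maxDeg-minus : ∀ G K → maxDeg (G minus K) ≤ maxDeg G
maxDeg-minus G K = maxDeg-lub (G minus K) λ j → ≤-trans (deg-minus G K j) (deg≤maxDeg G _)

-- Colouring a clique

pick : ∀ {m} {P : Fin m → Set} → Decidable P → Fin m → Fin m
pick P? fallback with any? P?
... | yes (γ , _) = γ
... | no _        = fallback

pick-spec : ∀ {m} {P : Fin m → Set} (P? : Decidable P) fallback → ∃ P → P (pick P? fallback)
pick-spec P? fallback ∃P with any? P?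
... | yes (_ , Pγ) = Pγ
... | no ¬∃P       = contradiction ∃P ¬∃P

module _ {k : ℕ} {A : Set} where

  recolour : (Fin k → A) → Fin k → A → Fin k → A
  recolour c w γ = updateAt c w (const γ)

  recolour-at : ∀ c w (γ : A) → recolour c w γ w ≡ γ
  recolour-at c w γ = updateAt-updates w c

  recolour-elsewhere : ∀ c {w} (γ : A) {x} → x ≢ w → recolour c w γ x ≡ c x
  recolour-elsewhere c {w} γ {x} = updateAt-minimal x w c

  module _ {c : Fin k → A} {γ : A} (c-inj : Injective _≡_ _≡_ c) (fresh : ∀ x → c x ≢ γ) (w : Fin k) where

    recolour-injective : Injective _≡_ _≡_ (recolour c w γ)
    recolour-injective {x} {y} eq with x ≟ w | y ≟ w
    ... | yes refl | yes refl = refl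
    ... | yes refl | no y≢w   =
      contradiction (trans (sym (recolour-elsewhere c γ y≢w)) (trans (sym eq) (recolour-at c w γ))) (fresh y)
    ... | no x≢w   | yes refl =
      contradiction (trans (sym (recolour-elsewhere c γ x≢w)) (trans eq (recolour-at c w γ))) (fresh x)
    ... | no x≢w   | no y≢w   =
      c-inj (trans (sym (recolour-elsewhere c γ x≢w)) (trans eq (recolour-elsewhere c γ y≢w)))

    recolour-drops : ∀ x → recolour c w γ x ≢ c w
    recolour-drops x eq with x ≟ w
    ... | yes refl = fresh w (trans (sym eq) (recolour-at c w γ))
    ... | no x≢w   = x≢w (c-inj (trans (sym (recolour-elsewhere c γ x≢w)) eq))

module _ {k m : ℕ} where

  UsedByOthers : (Fin k → Fin m) → Fin k → Fin m → Set
  UsedByOthers c x γ = ∃ λ w → w ≢ x × c w ≡ γ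

  usedByOthers? : ∀ c x γ → Dec (UsedByOthers c x γ)
  usedByOthers? c x γ = any? λ w → ¬? (w ≟ x) ×-dec c w ≟ γ

  usedByOthers : (Fin k → Fin m) → Fin k → Fin m → Bool
  usedByOthers c x γ = does (usedByOthers? c x γ)

  usedByOthers-true : ∀ c {x γ} w → w ≢ x → c w ≡ γ → usedByOthers c x γ ≡ true
  usedByOthers-true c {x} {γ} w w≢x cw≡γ = dec-true (usedByOthers? c x γ) (w , w≢x , cw≡γ)

  usedByOthers-false : ∀ c {x γ} → (∀ w → w ≢ x → c w ≢ γ) → usedByOthers c x γ ≡ false
  usedByOthers-false c {x} {γ} unused =
    dec-false (usedByOthers? c x γ) λ (w , w≢x , cw≡γ) → unused w w≢x cw≡γ

  usedByOthers-witness : ∀ c {x γ} → usedByOthers c x γ ≡ true → UsedByOthers c x γ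
  usedByOthers-witness c {x} {γ} used with usedByOthers? c x γ
  ... | yes witness = witness

  usedByOthers-recolour : ∀ c x γ δ → usedByOthers (recolour c x γ) x δ ≡ usedByOthers c x δ
  usedByOthers-recolour c x γ δ with usedByOthers c x δ in used
  ... | true  with w , w≢x , cw≡δ ← usedByOthers-witness c used =
    usedByOthers-true _ w w≢x (trans (recolour-elsewhere c γ w≢x) cw≡δ)
  ... | false = usedByOthers-false _ λ w w≢x c′w≡δ →
    contradiction (trans (sym used) (usedByOthers-true c w w≢x (trans (sym (recolour-elsewhere c γ w≢x)) c′w≡δ)))
                  λ ()

Admissible : ∀ {k m} → (Fin k → List (Fin m)) → (Fin k → Fin m) → Set
Admissible F c = Injective _≡_ _≡_ c × (∀ x → c x ∉ F x)

greedy : ∀ {k m} (F : Fin k → List (Fin m)) → (∀ x → length (F x) + k < m) → ∃ (Admissible F)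
greedy {zero}      F room = (λ ()) , (λ { {()} }) , λ ()
greedy {suc k} {m} F room
  with γ , γ∉F₀ ← missing-colour (F zero) (≤-trans (s≤s (m≤m+n _ _)) (room zero))
  with c , c-inj , c∉ ← greedy (λ x → γ ∷ F (suc x)) (λ x → subst (λ t → suc t ≤ m) (+-suc _ k) (room (suc x)))
  =
  (γ ◂ c) , injective , avoids
  where
  injective : Injective _≡_ _≡_ (γ ◂ c)
  injective {zero}  {zero}  _  = refl
  injective {zero}  {suc y} eq = contradiction (here (sym eq)) (c∉ y)
  injective {suc x} {zero}  eq = contradiction (here eq) (c∉ x)
  injective {suc x} {suc y} eq = cong suc (c-inj eq)
  avoids : ∀ x → (γ ◂ c) x ∉ F x
  avoids zero    = γ∉F₀
  avoids (suc x) = c∉ x ∘ there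

∃-≢ : ∀ {k} → 2 ≤ k → (x : Fin k) → ∃ λ y → y ≢ x
∃-≢ {suc zero}    (s≤s ()) _
∃-≢ {suc (suc k)} _ zero    = suc zero , λ ()
∃-≢ {suc (suc k)} _ (suc x) = zero , λ ()

-- x ∈ K must avoid the colours F x, and oddAt x γ is the parity of γ among the neighbours
-- of x outside K. Under an injective c the vertex x sees γ an odd number of times iff
-- oddAt x γ ≢ usedByOthers c x γ; so x Fails when its odd outside colours are exactly
-- the colours of the other vertices of K.
module CliqueColouring {k m : ℕ} (F : Fin k → List (Fin m)) (oddAt : Fin k → Fin m → Bool)
  (oddAt⇒F : ∀ {x γ} → oddAt x γ ≡ true → γ ∈ F x) (room : ∀ x → length (F x) + k < m) where

  Fails : (Fin k → Fin m) → Fin k → Set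
  Fails c x = ∀ γ → oddAt x γ ≡ usedByOthers c x γ

  fails? : ∀ c x → Dec (Fails c x)
  fails? c x = all? λ γ → oddAt x γ Bool.≟ usedByOthers c x γ

  Good : (Fin k → Fin m) → Set
  Good c = ∀ x → ∃ λ γ → oddAt x γ ≢ usedByOthers c x γ

  no-failure⇒good : ∀ {c} → (∀ x → ¬ Fails c x) → Good c
  no-failure⇒good {c} ok x = ¬∀⟶∃¬ m _ (λ γ → oddAt x γ Bool.≟ usedByOthers c x γ) (ok x)

  recolour-admissible : ∀ {c γ} → Admissible F c → (∀ x → c x ≢ γ) → ∀ w → γ ∉ F w →
    Admissible F (recolour c w γ)
  recolour-admissible {c} {γ} (c-inj , c∉F) fresh w γ∉F = recolour-injective c-inj fresh w , avoids
    where
    avoids : ∀ x → recolour c w γ x ∉ F x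
    avoids x with x ≟ w
    ... | yes refl = subst (_∉ F w) (sym (recolour-at c w γ)) γ∉F
    ... | no x≢w   = subst (_∉ F x) (sym (recolour-elsewhere c γ x≢w)) (c∉F x)

  fails-recolour : ∀ c w γ → Fails (recolour c w γ) w → Fails c w
  fails-recolour c w γ fails δ = trans (fails δ) (usedByOthers-recolour c w γ δ)

  -- The old colour of w is odd at v but no longer used by the others.
  recolour-fixes : ∀ {c γ v} → Injective _≡_ _≡_ c → (∀ x → c x ≢ γ) → Fails c v → ∀ {w} → w ≢ v →
    ¬ Fails (recolour c w γ) v
  recolour-fixes {c} {γ} {v} c-inj fresh v-fails {w} w≢v fails′ = contradiction
    (trans (sym (trans (v-fails (c w)) (usedByOthers-true c w w≢v refl))) (fails′ (c w)))
    (λ eq → contradiction (trans eq (usedByOthers-false _ λ x _ → recolour-drops c-inj fresh w x)) λ ())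

  -- Giving w a fresh colour γ₀ repaired v but made u₁ fail. Then every colour of c other
  -- than c u₁ and c w is odd at u₁, hence forbidden there, so we recolour u₁ instead,
  -- also avoiding, for each vertex other than v and u₁, one odd colour unused by c.
  module _ {c : Fin k → Fin m} (c-adm : Admissible F c) {v w u₁ : Fin k} {γ₀ : Fin m}
    (v-fails : Fails c v) (γ₀-fresh : ∀ x → c x ≢ γ₀) (u₁≢v : u₁ ≢ v) (u₁≢w : u₁ ≢ w)
    (u₁-fails : Fails (recolour c w γ₀) u₁) where

    private
      c-inj = proj₁ c-adm

    c-in-F : ∀ x → x ≢ u₁ → x ≢ w → c x ∈ F u₁
    c-in-F x x≢u₁ x≢w =
      oddAt⇒F (trans (u₁-fails (c x)) (usedByOthers-true _ x x≢u₁ (recolour-elsewhere c γ₀ x≢w)))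

    u₁-ok : ¬ Fails c u₁
    u₁-ok fails = contradiction
      (trans (sym (trans (fails (c w)) (usedByOthers-true c w (u₁≢w ∘ sym) refl))) (u₁-fails (c w)))
      (λ eq → contradiction (trans eq (usedByOthers-false _ λ x _ → recolour-drops c-inj γ₀-fresh w x)) λ ())

    NewOdd : Fin k → Fin m → Set
    NewOdd u δ = oddAt u δ ≡ true × ¬ (∃ λ x → c x ≡ δ)

    newOdd? : ∀ u → Decidable (NewOdd u)
    newOdd? u δ = (oddAt u δ Bool.≟ true) ×-dec ¬? (any? λ x → c x ≟ δ)

    newOddColour : Fin k → Fin m
    newOddColour u = pick (newOdd? u) (c u₁)

    Rest : Fin k → Set
    Rest u = u ≢ v × u ≢ u₁

    rest? : Decidable Rest
    rest? u = ¬? (u ≟ v) ×-dec ¬? (u ≟ u₁)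

    avoid : List (Fin m)
    avoid = c u₁ ∷ c w ∷ map newOddColour (filter rest? (allFin k)) ++ F u₁

    avoid-short : length avoid < m
    avoid-short = begin-strict
      length avoid  ≡⟨ cong (2 +_) length-rest++F ⟩
      2 + (r + f)   ≡⟨ regroup r f ⟩
      (r + 2) + f   ≤⟨ +-monoˡ-≤ f r+2≤k ⟩
      k + f         ≡⟨ +-comm k f ⟩
      f + k         <⟨ room u₁ ⟩
      m             ∎
      where
      open ≤-Reasoning
      rest = filter rest? (allFin k)
      r = count (does ∘ rest?)
      f = length (F u₁)
      length-rest++F : length (map newOddColour rest ++ F u₁) ≡ r + f
      length-rest++F = trans (length-++ (map newOddColour rest))
        (cong (_+ f) (trans (length-map newOddColour rest) (length-filter-allFin rest?)))
      r+2≤k : r + 2 ≤ k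
      r+2≤k = count+2≤n (does ∘ rest?) u₁≢v (dec-false (rest? u₁) λ (_ , u₁≢u₁) → u₁≢u₁ refl)
                                          (dec-false (rest? v) λ (v≢v , _) → v≢v refl)
      regroup : ∀ r f → 2 + (r + f) ≡ (r + 2) + f
      regroup = solve-∀

    private
      γ₁ = proj₁ (missing-colour avoid avoid-short)
      γ₁∉avoid = proj₂ (missing-colour avoid avoid-short)

    γ₁∉F : γ₁ ∉ F u₁
    γ₁∉F = γ₁∉avoid ∘ there ∘ there ∘ ∈-++⁺ʳ _

    γ₁-fresh : ∀ x → c x ≢ γ₁
    γ₁-fresh x cx≡γ₁ with x ≟ u₁ | x ≟ w
    ... | yes refl | _        = γ₁∉avoid (here (sym cx≡γ₁))
    ... | no _     | yes refl = γ₁∉avoid (there (here (sym cx≡γ₁)))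
    ... | no x≢u₁  | no x≢w   = γ₁∉F (subst (_∈ F u₁) cx≡γ₁ (c-in-F x x≢u₁ x≢w))

    newOddColour≢γ₁ : ∀ u → Rest u → newOddColour u ≢ γ₁
    newOddColour≢γ₁ u rest eq =
      γ₁∉avoid (there (there (∈-++⁺ˡ (subst (_∈ _) eq
        (∈-map⁺ newOddColour (∈-filter⁺ rest? (∈-allFin u) rest))))))

    -- A failure at u would make γ₁ the only colour odd at u and unused by c.
    no-new-failure : ∀ u → Rest u → ¬ Fails (recolour c u₁ γ₁) u
    no-new-failure u rest@(_ , u≢u₁) fails = absurd (usedByOthers-witness c₂ used)
      where
      c₂ = recolour c u₁ γ₁
      γ₁-new : NewOdd u γ₁
      γ₁-new = trans (fails γ₁) (usedByOthers-true c₂ u₁ (u≢u₁ ∘ sym) (recolour-at c u₁ γ₁))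
             , λ (x , cx≡γ₁) → γ₁-fresh x cx≡γ₁
      δ-new = pick-spec (newOdd? u) (c u₁) (γ₁ , γ₁-new)
      used : usedByOthers c₂ u (newOddColour u) ≡ true
      used = trans (sym (fails _)) (proj₁ δ-new)
      absurd : ¬ UsedByOthers c₂ u (newOddColour u)
      absurd (x , _ , c₂x≡δ) with x ≟ u₁
      ... | yes refl = newOddColour≢γ₁ u rest (trans (sym c₂x≡δ) (recolour-at c u₁ γ₁))
      ... | no x≢u₁  = proj₂ δ-new (x , trans (sym (recolour-elsewhere c γ₁ x≢u₁)) c₂x≡δ)

    recolour-instead : ∃ λ c′ → Admissible F c′ × ∀ u → ¬ Fails c′ u
    recolour-instead = recolour c u₁ γ₁ , recolour-admissible c-adm γ₁-fresh u₁ γ₁∉F , ok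
      where
      ok : ∀ u → ¬ Fails (recolour c u₁ γ₁) u
      ok u with u ≟ v | u ≟ u₁
      ... | yes refl | _        = recolour-fixes c-inj γ₁-fresh v-fails u₁≢v
      ... | no _     | yes refl = u₁-ok ∘ fails-recolour c u₁ γ₁
      ... | no u≢v   | no u≢u₁  = no-new-failure u (u≢v , u≢u₁)

  fresh-colour : ∀ (c : Fin k → Fin m) w → ∃ λ γ → γ ∉ F w × ∀ x → c x ≢ γ
  fresh-colour c w =
    let γ , γ∉ = missing-colour (F w ++ tabulate c) short
    in γ , γ∉ ∘ ∈-++⁺ˡ
         , λ x cx≡γ → γ∉ (∈-++⁺ʳ (F w) (subst (_∈ tabulate c) cx≡γ (∈-tabulate⁺ x)))
    where
    short : length (F w ++ tabulate c) < m
    short = subst (_< m) (sym (trans (length-++ (F w)) (cong (length (F w) +_) (length-tabulate c)))) (room w)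

  repair : ∀ {c v w} → Admissible F c → Fails c v → w ≢ v →
    ∃ λ c′ → Admissible F c′ × ∀ u → Fails c′ u → u ≡ w × Fails c u
  repair {c} {v} {w} c-adm v-fails w≢v
    with γ₀ , γ₀∉F , γ₀-fresh ← fresh-colour c w
    with any? (λ u → ¬? (u ≟ v) ×-dec ¬? (u ≟ w) ×-dec fails? (recolour c w γ₀) u)
  ... | yes (u₁ , u₁≢v , u₁≢w , u₁-fails) =
    let c′ , c′-adm , ok = recolour-instead c-adm v-fails γ₀-fresh u₁≢v u₁≢w u₁-fails
    in c′ , c′-adm , λ u fails → contradiction fails (ok u)
  ... | no none = recolour c w γ₀ , recolour-admissible c-adm γ₀-fresh w γ₀∉F , only-w
    where
    only-w : ∀ u → Fails (recolour c w γ₀) u → u ≡ w × Fails c u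
    only-w u fails with u ≟ v | u ≟ w
    ... | yes refl | _        = contradiction fails (recolour-fixes (proj₁ c-adm) γ₀-fresh v-fails w≢v)
    ... | no _     | yes refl = refl , fails-recolour c w γ₀ fails
    ... | no u≢v   | no u≢w   = contradiction (u , u≢v , u≢w , fails) none

  good-if-one-failure : ∀ {c w} → Admissible F c → (∀ u → Fails c u → u ≡ w) → 2 ≤ k →
    ∃ λ c′ → Admissible F c′ × Good c′
  good-if-one-failure {c} {w} c-adm only-w two≤k with fails? c w
  ... | no w-ok = c , c-adm , no-failure⇒good λ u fails → w-ok (subst (Fails c) (only-w u fails) fails)
  ... | yes w-fails =
    let w′ , w′≢w = ∃-≢ two≤k w
        c′ , c′-adm , only-w′ = repair c-adm w-fails w′≢w
    in c′ , c′-adm , no-failure⇒good λ u fails →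
         let u≡w′ , fails-c = only-w′ u fails in w′≢w (trans (sym u≡w′) (only-w u fails-c))

  good-colouring : 2 ≤ k → ∃ λ c → Admissible F c × Good c
  good-colouring two≤k with c₀ , c₀-adm ← greedy F room with any? (fails? c₀)
  ... | no none = c₀ , c₀-adm , no-failure⇒good λ u fails → none (u , fails)
  ... | yes (v , v-fails) =
    let w , w≢v = ∃-≢ two≤k v
        c₁ , c₁-adm , only-w = repair c₀-adm v-fails w≢v
    in good-if-one-failure c₁-adm (λ u fails → proj₁ (only-w u fails)) two≤k

-- Extending an odd colouring of G − K

colourCount : (G : Graph) {m : ℕ} → (Fin (n G) → Fin m) → Fin (n G) → Fin m → ℕ
colourCount G c v γ = count (λ u → Adj G v u ∧ does (c u ≟ γ))

nbrsColoured≡colourCount : ∀ G {m} (c : Fin (n G) → Fin m) v γ → nbrsColoured G c v γ ≡ colourCount G c v γ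
nbrsColoured≡colourCount G c v γ = countB-allFin (λ u → Adj G v u ∧ does (c u ≟ γ))

isOdd-colourCount⇒odd : ∀ G {m} (c : Fin (n G) → Fin m) v γ →
  isOdd (colourCount G c v γ) ≡ true → nbrsColoured G c v γ % 2 ≡ 1
isOdd-colourCount⇒odd G c v γ odd =
  isOdd⇒%2≡1 (nbrsColoured G c v γ) (trans (cong isOdd (nbrsColoured≡colourCount G c v γ)) odd)

odd⇒isOdd-colourCount : ∀ G {m} (c : Fin (n G) → Fin m) v γ →
  nbrsColoured G c v γ % 2 ≡ 1 → isOdd (colourCount G c v γ) ≡ true
odd⇒isOdd-colourCount G c v γ odd =
  trans (cong isOdd (sym (nbrsColoured≡colourCount G c v γ))) (%2≡1⇒isOdd (nbrsColoured G c v γ) odd)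

module Extension (G : Graph) (K : Subset (n G)) (K-clique : IsClique G K)
  {m : ℕ} (φ : Fin (size (∁ K)) → Fin m) (φ-odd : IsOddColoring (G minus K) m φ) where

  H : Graph
  H = G minus K

  inK : Fin (size K) → Fin (n G)
  inK = emb K

  outK : Fin (size (∁ K)) → Fin (n G)
  outK = emb (∁ K)

  outAdj : Fin (size K) → Fin (size (∁ K)) → Bool
  outAdj x j = Adj G (inK x) (outK j)

  outNbrs : Fin (size K) → List (Fin (size (∁ K)))
  outNbrs x = filter (T? ∘ outAdj x) (allFin _)

  -- ψ of the proof idea; the fallback φ j is only taken when j is isolated in G − K.
  oddColour : Fin (size (∁ K)) → Fin m
  oddColour j = pick (λ γ → nbrsColoured H φ j γ % 2 ℕ.≟ 1) (φ j)

  forbidden : Fin (size K) → List (Fin m)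
  forbidden x = map φ (outNbrs x) ++ map oddColour (outNbrs x)

  oddOut : Fin (size K) → Fin m → Bool
  oddOut x γ = isOdd (count (λ j → outAdj x j ∧ does (φ j ≟ γ)))

  outNbr : ∀ {x j} → outAdj x j ≡ true → j ∈ outNbrs x
  outNbr {x} {j} adj = ∈-filter⁺ (T? ∘ outAdj x) (∈-allFin j) (Equivalence.from T-≡ adj)

  φ-forbidden : ∀ {x j} → outAdj x j ≡ true → φ j ∈ forbidden x
  φ-forbidden adj = ∈-++⁺ˡ (∈-map⁺ φ (outNbr adj))

  oddColour-forbidden : ∀ {x j} → outAdj x j ≡ true → oddColour j ∈ forbidden x
  oddColour-forbidden adj = ∈-++⁺ʳ _ (∈-map⁺ oddColour (outNbr adj))

  oddOut⇒forbidden : ∀ {x γ} → oddOut x γ ≡ true → γ ∈ forbidden x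
  oddOut⇒forbidden {x} {γ} odd with count-pos (λ j → outAdj x j ∧ does (φ j ≟ γ)) (isOdd⇒pos odd)
  ... | j , adj∧φj≡γ with outAdj x j in adj | φ j ≟ γ
  ...   | true | yes refl = φ-forbidden adj

  length-forbidden : ∀ x → length (forbidden x) ≡ count (outAdj x) + count (outAdj x)
  length-forbidden x = trans (length-++ (map φ (outNbrs x)))
    (cong₂ _+_ (trans (length-map φ (outNbrs x)) length-outNbrs)
               (trans (length-map oddColour (outNbrs x)) length-outNbrs))
    where
    length-outNbrs : length (outNbrs x) ≡ count (outAdj x)
    length-outNbrs = length-filter-allFin (T? ∘ outAdj x)

  clique-adj : ∀ x w → Adj G (inK x) (inK w) ≡ not (does (w ≟ x))
  clique-adj x w with w ≟ x
  ... | yes refl = irrefl G (inK x)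
  ... | no w≢x   = K-clique (inK x) (inK w) (lookup-emb K x) (lookup-emb K w) (w≢x ∘ sym ∘ emb-injective K)

  deg-inK : ∀ x → deg G (inK x) + 1 ≡ count (outAdj x) + size K
  deg-inK x = begin
    deg G (inK x) + 1                       ≡⟨ cong (_+ 1) (deg-split G K (inK x)) ⟩
    inside + count (outAdj x) + 1           ≡⟨ cong (_+ 1) (+-comm inside _) ⟩
    count (outAdj x) + inside + 1           ≡⟨ +-assoc (count (outAdj x)) inside 1 ⟩
    count (outAdj x) + (inside + 1)         ≡⟨ cong (count (outAdj x) +_) (+-comm inside 1) ⟩
    count (outAdj x) + suc inside           ≡⟨ cong (count (outAdj x) +_) inside+1≡k ⟩
    count (outAdj x) + size K               ∎
    where
    open ≡-Reasoning
    inside = count (λ w → Adj G (inK x) (inK w))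
    inside+1≡k : suc inside ≡ size K
    inside+1≡k = trans (sym (count-insert x (irrefl G (inK x)) refl λ w w≢x →
      trans (clique-adj x w) (cong not (dec-false (w ≟ x) w≢x)))) count-true

  deg-outK : ∀ j → deg G (outK j) ≡ count (λ i → Adj G (outK j) (inK i)) + deg H j
  deg-outK j = trans (deg-split G K (outK j))
    (cong (count (λ i → Adj G (outK j) (inK i)) +_) (sym (countB-allFin (Adj H j))))

  module _ (c : Fin (size K) → Fin m) (c-adm : Admissible forbidden c) where

    private
      c-inj = proj₁ c-adm
      c∉forbidden = proj₂ c-adm

    colouring : Fin (n G) → Fin m
    colouring = glue K c φ

    c≢φ : ∀ {i j} → outAdj i j ≡ true → c i ≢ φ j
    c≢φ adj ci≡φj = c∉forbidden _ (subst (_∈ _) (sym ci≡φj) (φ-forbidden adj))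

    proper-inK : ∀ i v → Adj G (inK i) v ≡ true → c i ≢ colouring v
    proper-inK i = emb-elim K inside outside
      where
      inside : ∀ i′ → Adj G (inK i) (inK i′) ≡ true → c i ≢ colouring (inK i′)
      inside i′ adj ci≡ with c-inj (trans ci≡ (glue-emb K c φ i′))
      ... | refl = contradiction (trans (sym adj) (irrefl G (inK i))) λ ()
      outside : ∀ j → outAdj i j ≡ true → c i ≢ colouring (outK j)
      outside j adj ci≡ = c≢φ adj (trans ci≡ (glue-emb∁ K c φ j))

    proper-outK : ∀ j v → Adj G (outK j) v ≡ true → φ j ≢ colouring v
    proper-outK j = emb-elim K inside outside
      where
      inside : ∀ i → Adj G (outK j) (inK i) ≡ true → φ j ≢ colouring (inK i)
      inside i adj φj≡ = c≢φ (trans (Graph.sym G (inK i) (outK j)) adj) (sym (trans φj≡ (glue-emb K c φ i)))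
      outside : ∀ j′ → Adj G (outK j) (outK j′) ≡ true → φ j ≢ colouring (outK j′)
      outside j′ adj φj≡ = proj₁ φ-odd j j′ adj (trans φj≡ (glue-emb∁ K c φ j′))

    proper : ∀ u v → Adj G u v ≡ true → colouring u ≢ colouring v
    proper = emb-elim K (λ i v adj → proper-inK i v adj ∘ trans (sym (glue-emb K c φ i)))
                        (λ j v adj → proper-outK j v adj ∘ trans (sym (glue-emb∁ K c φ j)))

    inKCount outKCount : Fin (n G) → Fin m → ℕ
    inKCount  v γ = count (λ i → Adj G v (inK i) ∧ does (c i ≟ γ))
    outKCount v γ = count (λ j → Adj G v (outK j) ∧ does (φ j ≟ γ))

    odd-by-parts : ∀ v γ → isOdd (inKCount v γ) xor isOdd (outKCount v γ) ≡ true →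
      nbrsColoured G colouring v γ % 2 ≡ 1
    odd-by-parts v γ odd = isOdd-colourCount⇒odd G colouring v γ (begin
      isOdd (colourCount G colouring v γ)               ≡⟨ cong isOdd (count-split K _) ⟩
      isOdd (count (at v ∘ inK) + count (at v ∘ outK))
        ≡⟨ cong isOdd (cong₂ _+_ (count-cong at-inK) (count-cong at-outK)) ⟩
      isOdd (inKCount v γ + outKCount v γ)              ≡⟨ isOdd-+ (inKCount v γ) (outKCount v γ) ⟩
      isOdd (inKCount v γ) xor isOdd (outKCount v γ)    ≡⟨ odd ⟩
      true                                              ∎)
      where
      open ≡-Reasoning
      at : Fin (n G) → Fin (n G) → Bool
      at v u = Adj G v u ∧ does (colouring u ≟ γ)
      at-inK : ∀ i → at v (inK i) ≡ Adj G v (inK i) ∧ does (c i ≟ γ)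
      at-inK i = cong (λ δ → Adj G v (inK i) ∧ does (δ ≟ γ)) (glue-emb K c φ i)
      at-outK : ∀ j → at v (outK j) ≡ Adj G v (outK j) ∧ does (φ j ≟ γ)
      at-outK j = cong (λ δ → Adj G v (outK j) ∧ does (δ ≟ γ)) (glue-emb∁ K c φ j)

    odd-inK : ∀ x → (∃ λ γ → oddOut x γ ≢ usedByOthers c x γ) →
      ∃ λ γ → nbrsColoured G colouring (inK x) γ % 2 ≡ 1
    odd-inK x (γ , γ-good) = γ , odd-by-parts (inK x) γ
      (trans (cong (_xor oddOut x γ) inside-odd) (xor-≢ (γ-good ∘ sym)))
      where
      inside-odd : isOdd (inKCount (inK x) γ) ≡ usedByOthers c x γ
      inside-odd = trans (cong isOdd (count-cong λ w → cong (_∧ does (c w ≟ γ)) (clique-adj x w)))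
        (isOdd-count-unique (λ w → ¬? (w ≟ x) ×-dec c w ≟ γ)
                            λ (_ , cw≡γ) (_ , cw′≡γ) → c-inj (trans cw≡γ (sym cw′≡γ)))

    odd-outK-H : ∀ j → 0 < deg H j → ∃ λ γ → nbrsColoured G colouring (outK j) γ % 2 ≡ 1
    odd-outK-H j pos-H = oddColour j , odd-by-parts (outK j) (oddColour j)
      (cong₂ _xor_ (cong isOdd inside-none)
                   (odd⇒isOdd-colourCount H φ j _ (pick-spec _ (φ j) (proj₂ φ-odd j pos-H))))
      where
      inside-none : inKCount (outK j) (oddColour j) ≡ 0
      inside-none = count-false λ i →
        dec-false (T? (Adj G (outK j) (inK i)) ×-dec c i ≟ oddColour j) λ (adj , ci≡) →
        c∉forbidden i (subst (_∈ forbidden i) (sym ci≡)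
          (oddColour-forbidden (trans (Graph.sym G (inK i) (outK j)) (Equivalence.to T-≡ adj))))

    odd-outK-isolated : ∀ j → 0 < deg G (outK j) → deg H j ≡ 0 →
      ∃ λ γ → nbrsColoured G colouring (outK j) γ % 2 ≡ 1
    odd-outK-isolated j pos H-isolated = c i , odd-by-parts (outK j) (c i)
      (cong₂ _xor_ inside-odd (cong isOdd outside-none))
      where
      toK : Fin (size K) → Bool
      toK i = Adj G (outK j) (inK i)
      inside = count toK
      inside-pos : 0 < inside
      inside-pos = subst (0 <_) (trans (deg-outK j) (trans (cong (inside +_) H-isolated) (+-identityʳ inside))) pos
      i = proj₁ (count-pos toK inside-pos)
      adj = proj₂ (count-pos toK inside-pos)
      inside-odd : isOdd (inKCount (outK j) (c i)) ≡ true
      inside-odd = trans (isOdd-count-unique (λ i′ → T? (Adj G (outK j) (inK i′)) ×-dec c i′ ≟ c i)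
                           λ (_ , e) (_ , e′) → c-inj (trans e (sym e′)))
                         (dec-true (any? _) (i , Equivalence.from T-≡ adj , refl))
      outside-none : outKCount (outK j) (c i) ≡ 0
      outside-none = n≤0⇒n≡0 (≤-trans (count-mono {q = Adj H j} λ _ → ∧≡true⇒left)
                                      (≤-reflexive (trans (sym (countB-allFin (Adj H j))) H-isolated)))

    odd-outK : ∀ j → 0 < deg G (outK j) → ∃ λ γ → nbrsColoured G colouring (outK j) γ % 2 ≡ 1
    odd-outK j pos with 0 <? deg H j
    ... | yes pos-H = odd-outK-H j pos-H
    ... | no ¬pos-H = odd-outK-isolated j pos (n≤0⇒n≡0 (≮⇒≥ ¬pos-H))

    extend : (∀ x → 0 < deg G (inK x) → ∃ λ γ → oddOut x γ ≢ usedByOthers c x γ) → OddColorable G m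
    extend good = colouring , proper , emb-elim K (λ x pos → odd-inK x (good x pos)) odd-outK

extend-clique : ∀ G K → IsClique G K → ∀ {m} → 2 * maxDeg G + 3 ≤ m + size K → 2 ≤ size K →
  OddColorable (G minus K) m → OddColorable G m
extend-clique G K K-clique {m} room two≤k (φ , φ-odd) =
  let c , c-adm , good = good-colouring two≤k in extend c c-adm λ x _ → good x
  where
  open Extension G K K-clique φ φ-odd
  Δ = maxDeg G
  k = size K
  regroup : ∀ d k → suc (d + d + k) + k ≡ (d + k) + (d + k) + 1
  regroup = solve-∀
  twice : ∀ Δ → (Δ + 1) + (Δ + 1) + 1 ≡ 2 * Δ + 3
  twice = solve-∀
  forbidden-room : ∀ x → length (forbidden x) + k < m
  forbidden-room x = subst (λ t → t + k < m) (sym (length-forbidden x)) (+-cancelʳ-≤ k _ _ (begin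
    suc (d + d + k) + k          ≡⟨ regroup d k ⟩
    (d + k) + (d + k) + 1        ≤⟨ +-monoˡ-≤ 1 (+-mono-≤ d+k≤Δ+1 d+k≤Δ+1) ⟩
    (Δ + 1) + (Δ + 1) + 1        ≡⟨ twice Δ ⟩
    2 * Δ + 3                    ≤⟨ room ⟩
    m + k                        ∎))
    where
    open ≤-Reasoning
    d = count (outAdj x)
    d+k≤Δ+1 : d + k ≤ Δ + 1
    d+k≤Δ+1 = subst (_≤ Δ + 1) (deg-inK x) (+-monoˡ-≤ 1 (deg≤maxDeg G (inK x)))
  open CliqueColouring forbidden oddOut oddOut⇒forbidden forbidden-room

-- Sets K with at most one vertex

module Recolouring (H : Graph) {m : ℕ} (φ : Fin (n H) → Fin m) (φ-odd : IsOddColoring H m φ) (j₀ : Fin (n H)) where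

  oddColourBesides : Fin (n H) → Fin m
  oddColourBesides j = pick (λ δ → (nbrsColoured H φ j δ % 2 ℕ.≟ 1) ×-dec ¬? (δ ≟ φ j₀)) (φ j₀)

  module _ (b : Fin m) (b≢φj₀ : b ≢ φ j₀)
    (b-new : ∀ j → Adj H j₀ j ≡ true → φ j ≢ b × oddColourBesides j ≢ b) where

    private
      φ′ = recolour φ j₀ b

    proper′ : ∀ u v → Adj H u v ≡ true → φ′ u ≢ φ′ v
    proper′ u v adj with u ≟ j₀ | v ≟ j₀
    ... | yes refl | yes refl = contradiction (trans (sym adj) (irrefl H j₀)) λ ()
    ... | yes refl | no v≢j₀  = λ eq → proj₁ (b-new v adj)
      (trans (sym (recolour-elsewhere φ b v≢j₀)) (trans (sym eq) (recolour-at φ j₀ b)))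
    ... | no u≢j₀  | yes refl = λ eq → proj₁ (b-new u (trans (Graph.sym H j₀ u) adj))
      (trans (sym (recolour-elsewhere φ b u≢j₀)) (trans eq (recolour-at φ j₀ b)))
    ... | no u≢j₀  | no v≢j₀  = λ eq → proj₁ φ-odd u v adj
      (trans (sym (recolour-elsewhere φ b u≢j₀)) (trans eq (recolour-elsewhere φ b v≢j₀)))

    count-unchanged : ∀ j δ → (Adj H j j₀ ∧ does (b ≟ δ)) ≡ (Adj H j j₀ ∧ does (φ j₀ ≟ δ)) →
      colourCount H φ′ j δ ≡ colourCount H φ j δ
    count-unchanged j δ at-j₀ = count-cong same
      where
      same : ∀ u → (Adj H j u ∧ does (φ′ u ≟ δ)) ≡ (Adj H j u ∧ does (φ u ≟ δ))
      same u with u ≟ j₀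
      ... | yes refl = trans (cong (λ γ → Adj H j j₀ ∧ does (γ ≟ δ)) (recolour-at φ j₀ b)) at-j₀
      ... | no u≢j₀  = cong (λ γ → Adj H j u ∧ does (γ ≟ δ)) (recolour-elsewhere φ b u≢j₀)

    count-unchanged-far : ∀ {j} → Adj H j j₀ ≡ false → ∀ δ → colourCount H φ′ j δ ≡ colourCount H φ j δ
    count-unchanged-far {j} far δ = count-unchanged j δ (trans (cong (_∧ _) far) (sym (cong (_∧ _) far)))

    count-unchanged-besides : ∀ j {δ} → δ ≢ b → δ ≢ φ j₀ → colourCount H φ′ j δ ≡ colourCount H φ j δ
    count-unchanged-besides j {δ} δ≢b δ≢φj₀ = count-unchanged j δ (cong (Adj H j j₀ ∧_)
      (trans (dec-false (b ≟ δ) (δ≢b ∘ sym)) (sym (dec-false (φ j₀ ≟ δ) (δ≢φj₀ ∘ sym)))))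

    still-odd : ∀ {j δ} → colourCount H φ′ j δ ≡ colourCount H φ j δ →
      nbrsColoured H φ j δ % 2 ≡ 1 → nbrsColoured H φ′ j δ % 2 ≡ 1
    still-odd {j} {δ} same odd =
      isOdd-colourCount⇒odd H φ′ j δ (trans (cong isOdd same) (odd⇒isOdd-colourCount H φ j δ odd))

    count-gains-b : ∀ j → Adj H j j₀ ≡ true → colourCount H φ′ j b ≡ suc (colourCount H φ j b)
    count-gains-b j adj = count-insert j₀
      (trans (cong (_∧ does (φ j₀ ≟ b)) adj) (dec-false (φ j₀ ≟ b) (b≢φj₀ ∘ sym)))
      (trans (cong₂ (λ a γ → a ∧ does (γ ≟ b)) adj (recolour-at φ j₀ b)) (dec-true (b ≟ b) refl))
      λ u u≢j₀ → cong (λ γ → Adj H j u ∧ does (γ ≟ b)) (sym (recolour-elsewhere φ b u≢j₀))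

    -- A neighbour of j₀ keeps an odd colour other than φ j₀ if it has one;
    -- otherwise b becomes odd there.
    odd′ : ∀ j → 0 < deg H j → ∃ λ γ → nbrsColoured H φ′ j γ % 2 ≡ 1
    odd′ j pos with Adj H j j₀ in adj
    ... | false = let γ , odd = proj₂ φ-odd j pos in γ , still-odd (count-unchanged-far adj γ) odd
    ... | true with any? (λ δ → (nbrsColoured H φ j δ % 2 ℕ.≟ 1) ×-dec ¬? (δ ≟ φ j₀))
    ...   | yes witness =
      let δ-odd , δ≢φj₀ = pick-spec _ (φ j₀) witness
      in oddColourBesides j ,
         still-odd (count-unchanged-besides j (proj₂ (b-new j (trans (Graph.sym H j₀ j) adj))) δ≢φj₀) δ-odd
    ...   | no none = b , isOdd-colourCount⇒odd H φ′ j b (trans (cong isOdd (count-gains-b j adj)) (cong not b-even))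
      where
      b-even : isOdd (colourCount H φ j b) ≡ false
      b-even = ¬-not λ odd → none (b , isOdd-colourCount⇒odd H φ j b odd , b≢φj₀)

    recolour-odd : IsOddColoring H m (recolour φ j₀ b)
    recolour-odd = proper′ , odd′

module SingleVertex (G : Graph) (K : Subset (n G)) (K-single : size K ≡ 1) {m : ℕ} (room : 2 * maxDeg G + 2 ≤ m) where

  x₀ : Fin (size K)
  x₀ = subst Fin (sym K-single) zero

  only-x₀ : ∀ x → x ≡ x₀
  only-x₀ x = Fin1-unique K-single x x₀
    where
    Fin1-unique : ∀ {k} → k ≡ 1 → (x y : Fin k) → x ≡ y
    Fin1-unique refl zero zero = refl

  K-clique : IsClique G K
  K-clique u v u∈K v∈K u≢v =
    let i , iu = emb-surjective K u∈K
        j , jv = emb-surjective K v∈K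
    in contradiction (trans (sym iu) (trans (cong (emb K) (trans (only-x₀ i) (sym (only-x₀ j)))) jv)) u≢v

  module _ (φ : Fin (size (∁ K)) → Fin m) (φ-odd : IsOddColoring (G minus K) m φ) where
    open Extension G K K-clique φ φ-odd

    extend-if-odd : (0 < deg G (inK x₀) → ∃ λ γ → oddOut x₀ γ ≡ true) → OddColorable G m
    extend-if-odd odd = extend c c-adm good
      where
      twice : ∀ Δ → suc (Δ + Δ + 1) ≡ 2 * Δ + 2
      twice = solve-∀
      forbidden-room : ∀ x → length (forbidden x) + size K < m
      forbidden-room x = subst (λ t → t + size K < m) (sym (length-forbidden x)) (begin-strict
        d + d + size K               ≡⟨ cong (d + d +_) K-single ⟩
        d + d + 1                    <⟨ s≤s (+-monoˡ-≤ 1 (+-mono-≤ d≤Δ d≤Δ)) ⟩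
        suc (maxDeg G + maxDeg G + 1) ≡⟨ twice (maxDeg G) ⟩
        2 * maxDeg G + 2             ≤⟨ room ⟩
        m                            ∎)
        where
        open ≤-Reasoning
        d = count (outAdj x)
        d≤Δ : d ≤ maxDeg G
        d≤Δ = subst (_≤ maxDeg G) (+-cancelʳ-≡ 1 _ _ (trans (deg-inK x) (cong (d +_) K-single))) (deg≤maxDeg G (inK x))
      c = proj₁ (greedy forbidden forbidden-room)
      c-adm = proj₂ (greedy forbidden forbidden-room)
      good : ∀ x → 0 < deg G (inK x) → ∃ λ γ → oddOut x γ ≢ usedByOthers c x γ
      good x pos rewrite only-x₀ x = let γ , odd-γ = odd pos in γ , λ eq →
        contradiction (trans (sym (usedByOthers-false c λ w w≢x₀ _ → w≢x₀ (only-x₀ w))) (trans (sym eq) odd-γ)) λ ()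

  module _ (φ : Fin (size (∁ K)) → Fin m) (φ-odd : IsOddColoring (G minus K) m φ)
    (all-even : ¬ ∃ λ γ → Extension.oddOut G K K-clique φ φ-odd x₀ γ ≡ true) (pos : 0 < deg G (emb K x₀)) where
    open Extension G K K-clique φ φ-odd

    private
      out-pos : 0 < count (outAdj x₀)
      out-pos = subst (0 <_) (+-cancelʳ-≡ 1 _ _ (trans (deg-inK x₀) (cong (count (outAdj x₀) +_) K-single))) pos
      j₀ = proj₁ (count-pos (outAdj x₀) out-pos)
      x₀j₀ = proj₂ (count-pos (outAdj x₀) out-pos)

    open Recolouring H φ φ-odd j₀

    nbrs₀ : List (Fin (n H))
    nbrs₀ = filter (T? ∘ Adj H j₀) (allFin _)

    avoid : List (Fin m)
    avoid = φ j₀ ∷ map φ nbrs₀ ++ map oddColourBesides nbrs₀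

    avoid-short : length avoid < m
    avoid-short = begin-strict
      length avoid                    ≡⟨ cong suc length-lists ⟩
      suc (deg H j₀ + deg H j₀)       <⟨ s≤s (s≤s (+-mono-≤ deg≤Δ deg≤Δ)) ⟩
      suc (suc (maxDeg G + maxDeg G)) ≡⟨ twice (maxDeg G) ⟩
      2 * maxDeg G + 2                ≤⟨ room ⟩
      m                               ∎
      where
      open ≤-Reasoning
      length-nbrs₀ : length nbrs₀ ≡ deg H j₀
      length-nbrs₀ = trans (length-filter-allFin (T? ∘ Adj H j₀)) (sym (countB-allFin (Adj H j₀)))
      length-lists : length (map φ nbrs₀ ++ map oddColourBesides nbrs₀) ≡ deg H j₀ + deg H j₀
      length-lists = trans (length-++ (map φ nbrs₀)) (cong₂ _+_
        (trans (length-map φ nbrs₀) length-nbrs₀) (trans (length-map oddColourBesides nbrs₀) length-nbrs₀))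
      deg≤Δ : deg H j₀ ≤ maxDeg G
      deg≤Δ = ≤-trans (deg≤maxDeg H j₀) (maxDeg-minus G K)
      twice : ∀ Δ → suc (suc (Δ + Δ)) ≡ 2 * Δ + 2
      twice = solve-∀

    private
      b = proj₁ (missing-colour avoid avoid-short)
      b∉avoid = proj₂ (missing-colour avoid avoid-short)

    b-new : ∀ j → Adj H j₀ j ≡ true → φ j ≢ b × oddColourBesides j ≢ b
    b-new j adj = (λ φj≡b → b∉avoid (there (∈-++⁺ˡ (subst (_∈ map φ nbrs₀) φj≡b (∈-map⁺ φ j∈nbrs₀)))))
                , (λ ωj≡b → b∉avoid (there (∈-++⁺ʳ (map φ nbrs₀)
                     (subst (_∈ map oddColourBesides nbrs₀) ωj≡b (∈-map⁺ oddColourBesides j∈nbrs₀)))))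
      where
      j∈nbrs₀ = ∈-filter⁺ (T? ∘ Adj H j₀) (∈-allFin j) (Equivalence.from T-≡ adj)

    b≢φj₀ : b ≢ φ j₀
    b≢φj₀ = b∉avoid ∘ here

    recoloured-odd : IsOddColoring H m (recolour φ j₀ b)
    recoloured-odd = recolour-odd b b≢φj₀ b-new

    -- j₀ no longer contributes the colour φ j₀ to x₀, whose count was even.
    odd-after : Extension.oddOut G K K-clique (recolour φ j₀ b) recoloured-odd x₀ (φ j₀) ≡ true
    odd-after =
      trans (sym (not-involutive _)) (cong not (trans (cong isOdd (sym lost)) (¬-not (all-even ∘ (φ j₀ ,_)))))
      where
      at : (Fin (n H) → Fin m) → Fin (n H) → Bool
      at ψ j = outAdj x₀ j ∧ does (ψ j ≟ φ j₀)
      lost : count (at φ) ≡ suc (count (at (recolour φ j₀ b)))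
      lost = count-insert j₀
        (trans (cong (λ γ → outAdj x₀ j₀ ∧ does (γ ≟ φ j₀)) (recolour-at φ j₀ b))
               (trans (cong (outAdj x₀ j₀ ∧_) (dec-false (b ≟ φ j₀) b≢φj₀)) (Bool.∧-zeroʳ _)))
        (trans (cong (_∧ does (φ j₀ ≟ φ j₀)) x₀j₀) (dec-true (φ j₀ ≟ φ j₀) refl))
        λ j j≢j₀ → cong (λ γ → outAdj x₀ j ∧ does (γ ≟ φ j₀)) (recolour-elsewhere φ b j≢j₀)

  extend-vertex : OddColorable (G minus K) m → OddColorable G m
  extend-vertex (φ , φ-odd)
    with any? (λ γ → Extension.oddOut G K K-clique φ φ-odd x₀ γ Bool.≟ true) | 0 <? deg G (emb K x₀)
  ... | yes odd     | _       = extend-if-odd φ φ-odd λ _ → odd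
  ... | no _        | no ¬pos = extend-if-odd φ φ-odd λ pos → contradiction pos ¬pos
  ... | no all-even | yes pos =
    extend-if-odd _ (recoloured-odd φ φ-odd all-even pos) λ _ → _ , odd-after φ φ-odd all-even pos

oddColourable-2Δ+2 : ∀ G {m} → 2 * maxDeg G + 2 ≤ m → OddColorable G m
oddColourable-2Δ+2 G = by-order (n G) G refl
  where
  by-order : ∀ N G {m} → n G ≡ N → 2 * maxDeg G + 2 ≤ m → OddColorable G m
  by-order zero    G refl room = (λ ()) , (λ ()) , λ ()
  by-order (suc N) G n≡ room =
    SingleVertex.extend-vertex G ⁅ v₀ ⁆ (trans (size≡∣∣ ⁅ v₀ ⁆) (∣⁅x⁆∣≡1 v₀)) room
      (by-order N (G minus ⁅ v₀ ⁆) rest (≤-trans (+-monoˡ-≤ 2 (*-monoʳ-≤ 2 (maxDeg-minus G ⁅ v₀ ⁆))) room))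
    where
    v₀ : Fin (n G)
    v₀ = subst Fin (sym n≡) zero
    rest : size (∁ ⁅ v₀ ⁆) ≡ N
    rest = trans (size≡∣∣ (∁ ⁅ v₀ ⁆)) (trans (∣∁p∣≡n∸∣p∣ ⁅ v₀ ⁆) (cong₂ _∸_ n≡ (∣⁅x⁆∣≡1 v₀)))

lemma3p1 : (G : Graph) (K : Subset (n G)) → IsClique G K → (m : ℕ) →
    2 * maxDeg G + 3 ≤ m + size K →
    OddColorable (G minus K) m → OddColorable G m
lemma3p1 G K K-clique m room with 2 ≤? size K
... | yes two≤k = extend-clique G K K-clique room two≤k
... | no  k≱2   = λ _ → oddColourable-2Δ+2 G (+-cancelʳ-≤ 1 _ _ (begin
  2 * maxDeg G + 2 + 1 ≡⟨ +-assoc (2 * maxDeg G) 2 1 ⟩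
  2 * maxDeg G + 3     ≤⟨ room ⟩
  m + size K           ≤⟨ +-monoʳ-≤ m (≤-pred (≰⇒> k≱2)) ⟩
  m + 1                ∎))
  where open ≤-Reasoning
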